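{- Let $G$ be a connected graph with $n$ vertices. Then every vertex of $G$ has at most one metamour (i.e., the maximum metamour-degree of $G$ is at most $1$) if and only if either (a) $G\in\{K_1,K_2,P_4\}$, or (b) $n\ge3$ and $G=K_n-\mu$ for some (possibly empty) matching $\mu$ of $K_n$.
   Context: All graphs are finite, simple and have at least one vertex; isomorphic graphs are regarded as equal. A vertex $v$ is a metamour of a vertex $w$ in $G$ if their distance in $G$ equals $2$. The maximum metamour-degree of $G$ is the maximum over its vertices of the number of metamours. $P_4$ is the path on $4$ vertices; for a set $\nu$ of edges, $G-\nu$ has the same vertices and edge set $E(G)\setminus\nu$. -}

module Defs where

open import Data.Nat using (ℕ; suc; _+_; _≡ᵇ_)
open import Data.Bool using (Bool; true; false; not; _∧_; _∨_)
open import Data.Fin using (Fin; toℕ; _≟_)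
open import Data.Product using (Σ; _×_; _,_)
open import Relation.Binary.PropositionalEquality using (_≡_; _≢_)
open import Relation.Nullary using (¬_)
open import Relation.Nullary.Decidable using (⌊_⌋)
open import Function.Bundles using (_↔_; Inverse)

record Graph (n : ℕ) : Set where
  field
    adj   : Fin n → Fin n → Bool
    adj-sym    : ∀ u v → adj u v ≡ adj v u
    adj-irrefl : ∀ v → adj v v ≡ false
open Graph public

Adj : ∀ {n} → Graph n → Fin n → Fin n → Set
Adj G u v = adj G u v ≡ true

data Walk {n} (G : Graph n) : Fin n → Fin n → Set where
  here : ∀ {v} → Walk G v v
  step : ∀ {u v w} → Adj G u v → Walk G v w → Walk G u w

Connected : ∀ {n} → Graph n → Set
Connected G = ∀ u v → Walk G u v

-- w is a metamour of v: distance exactly 2, i.e. distinct, non-adjacent,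
-- with a common neighbour.
Metamour : ∀ {n} → Graph n → Fin n → Fin n → Set
Metamour G v w = v ≢ w × ¬ Adj G v w × Σ _ (λ x → Adj G v x × Adj G x w)

MaxMetamourDeg≤1 : ∀ {n} → Graph n → Set
MaxMetamourDeg≤1 G = ∀ v w₁ w₂ → Metamour G v w₁ → Metamour G v w₂ → w₁ ≡ w₂

record _≅_ {n m} (G : Graph n) (H : Graph m) : Set where
  field
    bij : Fin n ↔ Fin m
    preserves : ∀ u v → adj G u v ≡ adj H (Inverse.to bij u) (Inverse.to bij v)

K : (n : ℕ) → Graph n
K n = record { adj = λ u v → not ⌊ u ≟ v ⌋ ; adj-sym = symK ; adj-irrefl = irrK }
  where
  open import Relation.Binary.PropositionalEquality using (refl; sym; cong)
  open import Relation.Nullary using (yes; no)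
  symK : ∀ u v → not ⌊ u ≟ v ⌋ ≡ not ⌊ v ≟ u ⌋
  symK u v with u ≟ v | v ≟ u
  ... | yes _ | yes _ = refl
  ... | no _  | no _  = refl
  ... | yes p | no q  with q (sym p)
  ... | ()
  symK u v | no q | yes p with q (sym p)
  ... | ()
  irrK : ∀ v → not ⌊ v ≟ v ⌋ ≡ false
  irrK v with v ≟ v
  ... | yes _ = refl
  ... | no q with q refl
  ... | ()

K₁ : Graph 1
K₁ = K 1

K₂ : Graph 2
K₂ = K 2

P₄ : Graph 4
P₄ = record { adj = a ; adj-sym = s ; adj-irrefl = i }
  where
  open import Data.Bool.Properties using (∨-comm)
  open import Relation.Binary.PropositionalEquality using (refl)
  a : Fin 4 → Fin 4 → Bool
  a u v = ((toℕ u + 1) ≡ᵇ toℕ v) ∨ ((toℕ v + 1) ≡ᵇ toℕ u)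
  s : ∀ u v → a u v ≡ a v u
  s u v = ∨-comm ((toℕ u + 1) ≡ᵇ toℕ v) ((toℕ v + 1) ≡ᵇ toℕ u)
  i : ∀ v → a v v ≡ false
  i Fin.zero = refl
  i (Fin.suc Fin.zero) = refl
  i (Fin.suc (Fin.suc Fin.zero)) = refl
  i (Fin.suc (Fin.suc (Fin.suc Fin.zero))) = refl

record Matching (n : ℕ) : Set where
  field
    edge   : Fin n → Fin n → Bool
    edge-sym    : ∀ u v → edge u v ≡ edge v u
    edge-irrefl : ∀ v → edge v v ≡ false
    disjoint : ∀ u v w → edge u v ≡ true → edge u w ≡ true → v ≡ w
open Matching public

K-minus : (n : ℕ) → Matching n → Graph n
K-minus n μ = record
  { adj = λ u v → Graph.adj (K n) u v ∧ not (edge μ u v)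
  ; adj-sym = λ u v → cong₂ (λ x y → x ∧ not y) (adj-sym (K n) u v) (edge-sym μ u v)
  ; adj-irrefl = λ v → subst (λ x → x ∧ not (edge μ v v) ≡ false) (sym (adj-irrefl (K n) v)) refl
  }
  where open import Relation.Binary.PropositionalEquality using (cong₂; subst; sym; refl)

-- Call two vertices near if their distance is at most 2.  If all pairs are
-- near, the non-adjacent pairs of distinct vertices are exactly the metamour
-- pairs, so the bound on metamour-degrees makes them a matching μ and
-- G = K_n − μ.  Otherwise a walk between two vertices that are not near
-- leaves the near-set of its start along an edge, which yields a path
-- x₀ x₁ x₂ x₃ with x₀ and x₃ not near.  The metamour bound then forbids any
-- further vertex adjacent to this path, so by connectivity G = P₄.
-- Conversely, a metamour of v in K_n − μ is its μ-partner, and P₄ is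
-- checked by enumeration.
module Submission where

open import Data.Nat using (ℕ; suc; _≤_; s≤s; z≤n)
open import Data.Fin using (Fin; zero; suc; _≟_)
open import Data.Fin.Properties using (any?; all?)
open import Data.Bool using (Bool; true; false; not; _∧_)
open import Data.Bool.Properties
  using (not-involutive; ¬-not; not-¬; ∧-conicalˡ; ∧-conicalʳ) renaming (_≟_ to _≟ᵇ_)
open import Data.Product using (Σ; ∃; ∃₂; _×_; _,_; proj₁; proj₂)
open import Data.Sum using (_⊎_; inj₁; inj₂)
open import Data.Empty using (⊥-elim)
open import Function using (_∘_; id)
open import Function.Bundles using (Inverse; Injection; _⇔_; mk⇔; mk↔ₛ′)
open import Function.Properties.Inverse using (↔⇒↣)
open import Relation.Nullary using (¬_; Dec; yes; no; ¬?)
open import Relation.Nullary.Decidable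
  using (_×-dec_; _⊎-dec_; _→-dec_; toWitness; decidable-stable)
open import Relation.Unary using (Pred; Decidable)
open import Relation.Binary.PropositionalEquality

open import Defs

pattern 0F = zero
pattern 1F = suc zero
pattern 2F = suc (suc zero)
pattern 3F = suc (suc (suc zero))

module _ {n} {G : Graph n} where

  walk-closed : ∀ {p} (P : Pred (Fin n) p) → (∀ {a b} → P a → Adj G a b → P b) →
                ∀ {a b} → Walk G a b → P a → P b
  walk-closed P closed here        pa = pa
  walk-closed P closed (step e w) pa = walk-closed P closed w (closed pa e)

  walk-exit : ∀ {p} {P : Pred (Fin n) p} → Decidable P → ∀ {a b} → Walk G a b → P a → ¬ P b →
              ∃₂ λ p z → P p × ¬ P z × Adj G p z
  walk-exit P? here pa ¬pb = ⊥-elim (¬pb pa)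
  walk-exit P? (step {v = c} e w) pa ¬pb with P? c
  ... | yes pc = walk-exit P? w pc ¬pb
  ... | no ¬pc = _ , c , pa , ¬pc , e

module _ {n} (G : Graph n) where

  Adj-sym : ∀ {u v} → Adj G u v → Adj G v u
  Adj-sym {u} {v} u~v = trans (adj-sym G v u) u~v

  Adj⇒≢ : ∀ {u v} → Adj G u v → u ≢ v
  Adj⇒≢ {u} u~u refl with trans (sym u~u) (adj-irrefl G u)
  ... | ()

  Metamour-sym : ∀ {v w} → Metamour G v w → Metamour G w v
  Metamour-sym (v≢w , v≁w , x , v~x , x~w) =
    v≢w ∘ sym , v≁w ∘ Adj-sym , x , Adj-sym x~w , Adj-sym v~x

  Adj? : ∀ u v → Dec (Adj G u v)
  Adj? u v = adj G u v ≟ᵇ true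

  Metamour? : ∀ v w → Dec (Metamour G v w)
  Metamour? v w = ¬? (v ≟ w) ×-dec ¬? (Adj? v w) ×-dec any? (λ x → Adj? v x ×-dec Adj? x w)

  MaxMetamourDeg≤1? : Dec (MaxMetamourDeg≤1 G)
  MaxMetamourDeg≤1? = all? λ v → all? λ w₁ → all? λ w₂ →
    Metamour? v w₁ →-dec Metamour? v w₂ →-dec w₁ ≟ w₂

  Near : Fin n → Fin n → Set
  Near u z = u ≡ z ⊎ Adj G u z ⊎ Metamour G u z

  Near? : ∀ u z → Dec (Near u z)
  Near? u z = u ≟ z ⊎-dec Adj? u z ⊎-dec Metamour? u z

  Near-sym : ∀ {u z} → Near u z → Near z u
  Near-sym (inj₁ u≡z)        = inj₁ (sym u≡z)
  Near-sym (inj₂ (inj₁ u~z)) = inj₂ (inj₁ (Adj-sym u~z))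
  Near-sym (inj₂ (inj₂ m))   = inj₂ (inj₂ (Metamour-sym m))

  TwinFree : Set
  TwinFree = ∀ i j → (∀ k → adj G i k ≡ adj G j k) → i ≡ j

  TwinFree? : Dec TwinFree
  TwinFree? = all? λ i → all? λ j → all? (λ k → adj G i k ≟ᵇ adj G j k) →-dec i ≟ j

module _ {n m} {G : Graph n} {H : Graph m} (G≅H : G ≅ H) where
  open _≅_ G≅H
  private
    f = Inverse.to bij

  ≅-injective : ∀ {x y} → f x ≡ f y → x ≡ y
  ≅-injective = Injection.injective (↔⇒↣ bij)

  ≅-preserves-Metamour : ∀ {v w} → Metamour G v w → Metamour H (f v) (f w)
  ≅-preserves-Metamour {v} {w} (v≢w , v≁w , x , v~x , x~w) =
    v≢w ∘ ≅-injective , v≁w ∘ trans (preserves v w) , f x ,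
    trans (sym (preserves v x)) v~x , trans (sym (preserves x w)) x~w

  ≅-reflects-MaxMetamourDeg≤1 : MaxMetamourDeg≤1 H → MaxMetamourDeg≤1 G
  ≅-reflects-MaxMetamourDeg≤1 bound v w₁ w₂ m₁ m₂ =
    ≅-injective (bound (f v) (f w₁) (f w₂) (≅-preserves-Metamour m₁) (≅-preserves-Metamour m₂))

same-adj⇒≅ : ∀ {n} {G H : Graph n} → (∀ u v → adj G u v ≡ adj H u v) → G ≅ H
same-adj⇒≅ same = record { bij = mk↔ₛ′ id id (λ _ → refl) (λ _ → refl) ; preserves = same }

module _ {n m} {G : Graph n} {H : Graph m} (f : Fin m → Fin n)
         (embeds : ∀ i j → adj G (f i) (f j) ≡ adj H i j) where

  twin-free-embedding-injective : TwinFree H → ∀ {i j} → f i ≡ f j → i ≡ j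
  twin-free-embedding-injective twin-free {i} {j} fi≡fj = twin-free i j λ k →
    begin
      adj H i k         ≡⟨ sym (embeds i k) ⟩
      adj G (f i) (f k) ≡⟨ cong (λ x → adj G x (f k)) fi≡fj ⟩
      adj G (f j) (f k) ≡⟨ embeds j k ⟩
      adj H j k         ∎
    where open ≡-Reasoning

  surjective-embedding⇒≅ : TwinFree H → (∀ y → ∃ λ i → f i ≡ y) → G ≅ H
  surjective-embedding⇒≅ twin-free onto = record
    { bij       = mk↔ₛ′ (proj₁ ∘ onto) f
                    (λ i → twin-free-embedding-injective twin-free (proj₂ (onto (f i))))
                    (proj₂ ∘ onto)
    ; preserves = λ u v → trans (sym (cong₂ (adj G) (proj₂ (onto u)) (proj₂ (onto v))))
                                (embeds (proj₁ (onto u)) (proj₁ (onto v)))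
    }

K-adj : ∀ {n} {u v : Fin n} → u ≢ v → Adj (K n) u v
K-adj {u = u} {v} u≢v with u ≟ v
... | yes u≡v = ⊥-elim (u≢v u≡v)
... | no _    = refl

K-metamour-free : ∀ {n} {v w : Fin n} → ¬ Metamour (K n) v w
K-metamour-free (v≢w , v≁w , _) = v≁w (K-adj v≢w)

K-MaxMetamourDeg≤1 : ∀ n → MaxMetamourDeg≤1 (K n)
K-MaxMetamourDeg≤1 n v w₁ w₂ m₁ _ = ⊥-elim (K-metamour-free m₁)

K-minus-metamour⇒edge : ∀ {n} (μ : Matching n) {v w} →
                        Metamour (K-minus n μ) v w → edge μ v w ≡ true
K-minus-metamour⇒edge μ (v≢w , v≁w , _) =
  ¬-not λ unmatched → v≁w (cong₂ (λ a e → a ∧ not e) (K-adj v≢w) unmatched)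

K-minus-MaxMetamourDeg≤1 : ∀ n μ → MaxMetamourDeg≤1 (K-minus n μ)
K-minus-MaxMetamourDeg≤1 n μ v w₁ w₂ m₁ m₂ =
  disjoint μ v w₁ w₂ (K-minus-metamour⇒edge μ m₁) (K-minus-metamour⇒edge μ m₂)

P₄-MaxMetamourDeg≤1 : MaxMetamourDeg≤1 P₄
P₄-MaxMetamourDeg≤1 = toWitness {a? = MaxMetamourDeg≤1? P₄} _

P₄-twin-free : TwinFree P₄
P₄-twin-free = toWitness {a? = TwinFree? P₄} _

record FarPath {n} (G : Graph n) : Set where
  field
    x₀ x₁ x₂ x₃ : Fin n
    x₀~x₁ : Adj G x₀ x₁
    x₁~x₂ : Adj G x₁ x₂
    x₂~x₃ : Adj G x₂ x₃
    x₀≁x₂ : ¬ Adj G x₀ x₂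
    x₀-far-x₃ : ¬ Near G x₀ x₃

module FarPathProperties {n} {G : Graph n} (P : FarPath G) where
  open FarPath P

  x₀≁x₃ : ¬ Adj G x₀ x₃
  x₀≁x₃ = x₀-far-x₃ ∘ inj₂ ∘ inj₁

  no-common-neighbour : ∀ y → Adj G x₀ y → ¬ Adj G y x₃
  no-common-neighbour y x₀~y y~x₃ =
    x₀-far-x₃ (inj₂ (inj₂ (x₀-far-x₃ ∘ inj₁ , x₀≁x₃ , y , x₀~y , y~x₃)))

  x₁≁x₃ : ¬ Adj G x₁ x₃
  x₁≁x₃ = no-common-neighbour x₁ x₀~x₁

  x₀-metamour-x₂ : Metamour G x₀ x₂
  x₀-metamour-x₂ =
    (λ x₀≡x₂ → x₀≁x₃ (subst (λ q → Adj G q x₃) (sym x₀≡x₂) x₂~x₃)) , x₀≁x₂ , x₁ , x₀~x₁ , x₁~x₂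

  x₁-metamour-x₃ : Metamour G x₁ x₃
  x₁-metamour-x₃ =
    (λ x₁≡x₃ → x₀≁x₃ (subst (Adj G x₀) x₁≡x₃ x₀~x₁)) , x₁≁x₃ , x₂ , x₁~x₂ , x₂~x₃

reverse : ∀ {n} {G : Graph n} → FarPath G → FarPath G
reverse {G = G} P = record
  { x₀ = x₃ ; x₁ = x₂ ; x₂ = x₁ ; x₃ = x₀
  ; x₀~x₁ = Adj-sym G x₂~x₃ ; x₁~x₂ = Adj-sym G x₁~x₂ ; x₂~x₃ = Adj-sym G x₀~x₁
  ; x₀≁x₂ = x₁≁x₃ ∘ Adj-sym G
  ; x₀-far-x₃ = x₀-far-x₃ ∘ Near-sym G
  }
  where open FarPath P; open FarPathProperties P

not-near⇒FarPath : ∀ {n} {G : Graph n} → Connected G → ∀ {u v} → ¬ Near G u v → FarPath G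
not-near⇒FarPath {G = G} conn {u} {v} u-far-v
  with walk-exit (Near? G u) (conn u v) (inj₁ refl) u-far-v
... | _ , _ , inj₁ refl , u-far-z , u~z = ⊥-elim (u-far-z (inj₂ (inj₁ u~z)))
... | p , _ , inj₂ (inj₁ u~p) , u-far-z , p~z =
  ⊥-elim (u-far-z (inj₂ (inj₂ (u-far-z ∘ inj₁ , u-far-z ∘ inj₂ ∘ inj₁ , p , u~p , p~z))))
... | p , z , inj₂ (inj₂ (_ , u≁p , x , u~x , x~p)) , u-far-z , p~z = record
  { x₀ = u ; x₁ = x ; x₂ = p ; x₃ = z
  ; x₀~x₁ = u~x ; x₁~x₂ = x~p ; x₂~x₃ = p~z ; x₀≁x₂ = u≁p ; x₀-far-x₃ = u-far-z }

module OutsideNeighbours {n} {G : Graph n} (bound : MaxMetamourDeg≤1 G) (P : FarPath G) where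
  open FarPath P
  open FarPathProperties P

  x₁-has-no-outside-neighbour : ∀ {y} → x₀ ≢ y → x₁ ≢ y → x₂ ≢ y → x₃ ≢ y → ¬ Adj G x₁ y
  x₁-has-no-outside-neighbour {y} x₀≢y x₁≢y x₂≢y x₃≢y x₁~y with Adj? G x₀ y | Adj? G y x₂
  ... | no x₀≁y | _ =
    x₂≢y (bound x₀ x₂ y x₀-metamour-x₂ (x₀≢y , x₀≁y , x₁ , x₀~x₁ , x₁~y))
  ... | yes _ | no y≁x₂ =
    x₀≢y (bound x₂ x₀ y (Metamour-sym G x₀-metamour-x₂)
                        (x₂≢y , y≁x₂ ∘ Adj-sym G , x₁ , Adj-sym G x₁~x₂ , x₁~y))
  ... | yes x₀~y | yes y~x₂ =
    x₁≢y (bound x₃ x₁ y (Metamour-sym G x₁-metamour-x₃)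
                        (x₃≢y , no-common-neighbour y x₀~y ∘ Adj-sym G , x₂ ,
                         Adj-sym G x₂~x₃ , Adj-sym G y~x₂))

  x₀-has-no-outside-neighbour : ∀ {y} → x₀ ≢ y → x₁ ≢ y → x₂ ≢ y → x₃ ≢ y → ¬ Adj G x₀ y
  x₀-has-no-outside-neighbour {y} x₀≢y x₁≢y x₂≢y x₃≢y x₀~y with Adj? G x₁ y
  ... | yes x₁~y = x₁-has-no-outside-neighbour x₀≢y x₁≢y x₂≢y x₃≢y x₁~y
  ... | no x₁≁y  =
    x₃≢y (bound x₁ x₃ y x₁-metamour-x₃ (x₁≢y , x₁≁y , x₀ , Adj-sym G x₀~x₁ , x₀~y))

module _ {n} {G : Graph n} (bound : MaxMetamourDeg≤1 G) (P : FarPath G) where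
  open FarPath P
  open FarPathProperties P
  open OutsideNeighbours

  path : Fin 4 → Fin n
  path 0F = x₀
  path 1F = x₁
  path 2F = x₂
  path 3F = x₃

  path-embeds : ∀ i j → adj G (path i) (path j) ≡ adj P₄ i j
  path-embeds 0F 0F = adj-irrefl G x₀
  path-embeds 1F 1F = adj-irrefl G x₁
  path-embeds 2F 2F = adj-irrefl G x₂
  path-embeds 3F 3F = adj-irrefl G x₃
  path-embeds 0F 1F = x₀~x₁
  path-embeds 1F 2F = x₁~x₂
  path-embeds 2F 3F = x₂~x₃
  path-embeds 0F 2F = ¬-not x₀≁x₂
  path-embeds 0F 3F = ¬-not x₀≁x₃
  path-embeds 1F 3F = ¬-not x₁≁x₃
  path-embeds 1F 0F = Adj-sym G x₀~x₁
  path-embeds 2F 1F = Adj-sym G x₁~x₂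
  path-embeds 3F 2F = Adj-sym G x₂~x₃
  path-embeds 2F 0F = ¬-not (x₀≁x₂ ∘ Adj-sym G)
  path-embeds 3F 0F = ¬-not (x₀≁x₃ ∘ Adj-sym G)
  path-embeds 3F 1F = ¬-not (x₁≁x₃ ∘ Adj-sym G)

  path-has-no-outside-neighbour : ∀ i {y} → (∀ j → path j ≢ y) → ¬ Adj G (path i) y
  path-has-no-outside-neighbour 0F off =
    x₀-has-no-outside-neighbour bound P (off 0F) (off 1F) (off 2F) (off 3F)
  path-has-no-outside-neighbour 1F off =
    x₁-has-no-outside-neighbour bound P (off 0F) (off 1F) (off 2F) (off 3F)
  path-has-no-outside-neighbour 2F off =
    x₁-has-no-outside-neighbour bound (reverse P) (off 3F) (off 2F) (off 1F) (off 0F)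
  path-has-no-outside-neighbour 3F off =
    x₀-has-no-outside-neighbour bound (reverse P) (off 3F) (off 2F) (off 1F) (off 0F)

  OnPath : Fin n → Set
  OnPath y = ∃ λ i → path i ≡ y

  OnPath-closed : ∀ {a b} → OnPath a → Adj G a b → OnPath b
  OnPath-closed {b = b} (i , refl) a~b with any? (λ j → path j ≟ b)
  ... | yes on-path = on-path
  ... | no off-path =
    ⊥-elim (path-has-no-outside-neighbour i (λ j pj≡b → off-path (j , pj≡b)) a~b)

  FarPath⇒≅P₄ : Connected G → G ≅ P₄
  FarPath⇒≅P₄ conn = surjective-embedding⇒≅ path path-embeds P₄-twin-free
    λ y → walk-closed OnPath OnPath-closed (conn x₀ y) (0F , refl)

module _ {n} (G : Graph n) where

  nonAdjacent : Fin n → Fin n → Bool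
  nonAdjacent u v = adj (K n) u v ∧ not (adj G u v)

  adj≡K-minus-nonAdjacent : ∀ u v → adj G u v ≡ adj (K n) u v ∧ not (nonAdjacent u v)
  adj≡K-minus-nonAdjacent u v with u ≟ v
  ... | yes refl = adj-irrefl G u
  ... | no _     = sym (not-involutive (adj G u v))

  module _ (near : ∀ u v → Near G u v) where

    nonAdjacent⇒Metamour : ∀ {u v} → nonAdjacent u v ≡ true → Metamour G u v
    nonAdjacent⇒Metamour {u} {v} u≁v with near u v
    ... | inj₁ u≡v = ⊥-elim (Adj⇒≢ (K n) (∧-conicalˡ _ _ u≁v) u≡v)
    ... | inj₂ (inj₁ u~v) = ⊥-elim (not-¬ (sym u~v) (sym (∧-conicalʳ _ _ u≁v)))
    ... | inj₂ (inj₂ u-metamour-v) = u-metamour-v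

    nonAdjacency-matching : MaxMetamourDeg≤1 G → Matching n
    nonAdjacency-matching bound = record
      { edge        = nonAdjacent
      ; edge-sym    = λ u v → cong₂ (λ k g → k ∧ not g) (adj-sym (K n) u v) (adj-sym G u v)
      ; edge-irrefl = λ v → cong (_∧ not (adj G v v)) (adj-irrefl (K n) v)
      ; disjoint    = λ u v w u≁v u≁w →
                        bound u v w (nonAdjacent⇒Metamour u≁v) (nonAdjacent⇒Metamour u≁w)
      }

graph₁≅K₁ : (G : Graph 1) → G ≅ K₁
graph₁≅K₁ G = same-adj⇒≅ λ { 0F 0F → adj-irrefl G 0F }

connected-graph₂≅K₂ : (G : Graph 2) → Connected G → G ≅ K₂
connected-graph₂≅K₂ G conn = same-adj⇒≅ adj≡
  where
  0~1 : Adj G 0F 1F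
  0~1 with conn 0F 1F
  ... | step {v = 0F} 0~0 _ = ⊥-elim (Adj⇒≢ G 0~0 refl)
  ... | step {v = 1F} 0~1 _ = 0~1

  adj≡ : ∀ u v → adj G u v ≡ adj K₂ u v
  adj≡ 0F 0F = adj-irrefl G 0F
  adj≡ 1F 1F = adj-irrefl G 1F
  adj≡ 0F 1F = 0~1
  adj≡ 1F 0F = Adj-sym G 0~1

Classified : (n : ℕ) → Graph n → Set
Classified n G = (G ≅ K₁ ⊎ G ≅ K₂ ⊎ G ≅ P₄) ⊎ (3 ≤ n × Σ (Matching n) (λ μ → G ≅ K-minus n μ))

all-near⇒Classified : ∀ n (G : Graph n) → 1 ≤ n → Connected G → MaxMetamourDeg≤1 G →
                      (∀ u v → Near G u v) → Classified n G
all-near⇒Classified 1 G _ _ _ _    = inj₁ (inj₁ (graph₁≅K₁ G))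
all-near⇒Classified 2 G _ conn _ _ = inj₁ (inj₂ (inj₁ (connected-graph₂≅K₂ G conn)))
all-near⇒Classified (suc (suc (suc _))) G _ _ bound near =
  inj₂ (s≤s (s≤s (s≤s z≤n)) , μ , same-adj⇒≅ {H = K-minus _ μ} (adj≡K-minus-nonAdjacent G))
  where μ = nonAdjacency-matching G near bound

classify : ∀ n (G : Graph n) → 1 ≤ n → Connected G → MaxMetamourDeg≤1 G → Classified n G
classify n G 1≤n conn bound with any? (λ u → any? (λ v → ¬? (Near? G u v)))
... | yes (_ , _ , u-far-v) =
  inj₁ (inj₂ (inj₂ (FarPath⇒≅P₄ bound (not-near⇒FarPath conn u-far-v) conn)))
... | no no-far-pair = all-near⇒Classified n G 1≤n conn bound λ u v →
  decidable-stable (Near? G u v) λ u-far-v → no-far-pair (u , v , u-far-v)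

Classified⇒MaxMetamourDeg≤1 : ∀ {n} {G : Graph n} → Classified n G → MaxMetamourDeg≤1 G
Classified⇒MaxMetamourDeg≤1 (inj₁ (inj₁ G≅K₁)) =
  ≅-reflects-MaxMetamourDeg≤1 G≅K₁ (K-MaxMetamourDeg≤1 1)
Classified⇒MaxMetamourDeg≤1 (inj₁ (inj₂ (inj₁ G≅K₂))) =
  ≅-reflects-MaxMetamourDeg≤1 G≅K₂ (K-MaxMetamourDeg≤1 2)
Classified⇒MaxMetamourDeg≤1 (inj₁ (inj₂ (inj₂ G≅P₄))) =
  ≅-reflects-MaxMetamourDeg≤1 G≅P₄ P₄-MaxMetamourDeg≤1
Classified⇒MaxMetamourDeg≤1 (inj₂ (_ , μ , G≅K-μ)) =
  ≅-reflects-MaxMetamourDeg≤1 G≅K-μ (K-minus-MaxMetamourDeg≤1 _ μ)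

theorem3p9 : (n : ℕ) (G : Graph n) → 1 ≤ n → Connected G →
    (MaxMetamourDeg≤1 G ⇔
      ((G ≅ K₁ ⊎ G ≅ K₂ ⊎ G ≅ P₄) ⊎ (3 ≤ n × Σ (Matching n) (λ μ → G ≅ K-minus n μ))))
theorem3p9 n G 1≤n conn = mk⇔ (classify n G 1≤n conn) Classified⇒MaxMetamourDeg≤1
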